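{- Let $m\ge 1$ and let ${\cal N}^*_m$ be the connected component of ${\cal D}^*_m$ containing the word $0^m$. If $v\in V({\cal N}^*_m)$, then $\overline{v}\in V({\cal N}^*_m)$ and $\rho^k(v)\in V({\cal N}^*_m)$ for every $0\le k\le m-1$.
   Context: Alpha-letters (2-element subsets of the directions up, down, left, right): $a=\{\text{right},\text{down}\}$, $b=\{\text{up},\text{down}\}$, $c=\{\text{right},\text{up}\}$, $d=\{\text{left},\text{down}\}$, $e=\{\text{left},\text{right}\}$, $f=\{\text{left},\text{up}\}$. ${\cal D}_{ud}$: arc $(\alpha,\beta)$ iff ($\text{down}\in\alpha\iff\text{up}\in\beta$); ${\cal D}_{lr}$: arc $(\alpha,\beta)$ iff ($\text{right}\in\alpha\iff\text{left}\in\beta$). ${\cal D}_m$: vertices are the words $\alpha_1\cdots\alpha_m\in\{a,\dots,f\}^m$ with $(\alpha_i,\alpha_{i+1})$ an arc of ${\cal D}_{ud}$ for $1\le i\le m$ ($\alpha_{m+1}:=\alpha_1$); arc $v\to u$ iff $(v_i,u_i)$ is an arc of ${\cal D}_{lr}$ for all $i$. Outlet word $o(\alpha)\in\{0,1\}^m$: $o_j=1$ iff $\alpha_j\in\{a,c,e\}$; inlet word $i(\alpha)$: $i_j=1$ iff $\alpha_j\in\{d,e,f\}$. ${\cal D}^*_m$: vertex set $\{o(x):x\in V({\cal D}_m)\}$, number of arcs from $v$ to $w$ equal to $|\{y\in V({\cal D}_m): i(y)=v,\ o(y)=w\}|$. For a binary word $v=b_1\cdots b_m$: $\overline{v}=b_m\cdots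 b_1$ and $\rho(v)=b_2\cdots b_mb_1$, $\rho^k$ its $k$-th iterate ($\rho^0$ the identity). Connected components are those of the underlying undirected multigraph. -}

module Defs where

open import Data.Bool using (Bool; true; false)
open import Data.Nat using (ℕ; zero; suc)
open import Data.Fin using (Fin)
open import Data.Vec using (Vec; []; _∷_; _∷ʳ_; lookup; map; replicate)
open import Data.Product using (Σ; _×_)
open import Relation.Binary.PropositionalEquality using (_≡_)

-- The six alpha-letters (2-element subsets of {up,down,left,right}).
-- a={right,down} b={up,down} c={right,up} d={left,down} e={left,right} f={left,up}
data Letter : Set where
  a b c d e f : Letter

hasUp hasDown hasLeft hasRight : Letter → Bool
hasUp a = false
hasUp b = true
hasUp c = true
hasUp d = false
hasUp e = false
hasUp f = true
hasDown a = true
hasDown b = true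
hasDown c = false
hasDown d = true
hasDown e = false
hasDown f = false
hasLeft a = false
hasLeft b = false
hasLeft c = false
hasLeft d = true
hasLeft e = true
hasLeft f = true
hasRight a = true
hasRight b = false
hasRight c = true
hasRight d = false
hasRight e = true
hasRight f = false

ArcUD : Letter → Letter → Set
ArcUD α β = hasDown α ≡ hasUp β

rot : ∀ {A : Set} {n : ℕ} → Vec A n → Vec A n
rot [] = []
rot (x ∷ xs) = xs ∷ʳ x

rotIter : ∀ {A : Set} {n : ℕ} → ℕ → Vec A n → Vec A n
rotIter zero v = v
rotIter (suc k) v = rot (rotIter k v)

-- vertices of D_m : words α₁⋯αₘ with (αᵢ, αᵢ₊₁) ∈ D_ud cyclically (αₘ₊₁ = α₁);
-- (rot w) at position i is the cyclic successor letter of w at i.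
IsDmVertex : ∀ {m : ℕ} → Vec Letter m → Set
IsDmVertex w = ∀ i → ArcUD (lookup w i) (lookup (rot w) i)

outL inL : Letter → Bool
outL a = true
outL b = false
outL c = true
outL d = false
outL e = true
outL f = false
inL a = false
inL b = false
inL c = false
inL d = true
inL e = true
inL f = true

outW inW : ∀ {m : ℕ} → Vec Letter m → Vec Bool m
outW = map outL
inW = map inL

IsStarVertex : ∀ {m : ℕ} → Vec Bool m → Set
IsStarVertex {m} v = Σ (Vec Letter m) (λ x → IsDmVertex x × outW x ≡ v)

StarArc : ∀ {m : ℕ} → Vec Bool m → Vec Bool m → Set
StarArc {m} v w =
  IsStarVertex v × IsStarVertex w ×
  Σ (Vec Letter m) (λ y → IsDmVertex y × inW y ≡ v × outW y ≡ w)

zeroWord : ∀ (m : ℕ) → Vec Bool m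
zeroWord m = replicate m false

-- vertices of the connected component N*_m of D*_m containing 0^m
-- (connectivity in the underlying undirected multigraph)
data InN* {m : ℕ} : Vec Bool m → Set where
  base : IsStarVertex (zeroWord m) → InN* (zeroWord m)
  fwd  : ∀ {v w} → InN* v → StarArc v w → InN* w
  bwd  : ∀ {v w} → InN* w → StarArc v w → InN* v

module Submission where

-- Both operations on binary words are shadows of symmetries of D_m: rotating a letter word,
-- and reversing it while swapping up and down (a ↔ c, d ↔ f).  Each symmetry preserves the
-- cyclic D_ud condition, commutes with the inlet and outlet maps (left/right are untouched)
-- and fixes 0^m, so the induced map on binary words sends arcs of D*_m to arcs and
-- therefore the component of 0^m into itself.

open import Defs
open import Data.Bool using (Bool)
open import Data.Nat using (ℕ; zero; suc; _≥_; _<_)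
open import Data.Fin using (Fin)
open import Data.Vec using (Vec; []; _∷_; _∷ʳ_; map; replicate; reverse; lookup)
open import Data.Vec.Properties using (map-∷ʳ; reverse-∷; map-reverse; map-∘; map-cong)
open import Data.Product using (_×_; _,_)
open import Function using (_∘_)
open import Relation.Binary.PropositionalEquality
  using (_≡_; refl; sym; trans; cong; subst; module ≡-Reasoning)

module Symmetry {m : ℕ}
  (φ : Vec Bool m → Vec Bool m) (Φ : Vec Letter m → Vec Letter m)
  (Φ-vertex : ∀ y → IsDmVertex y → IsDmVertex (Φ y))
  (outW-Φ : ∀ y → outW (Φ y) ≡ φ (outW y))
  (inW-Φ : ∀ y → inW (Φ y) ≡ φ (inW y))
  (φ-zeroWord : φ (zeroWord m) ≡ zeroWord m) where

  starVertex : ∀ {v} → IsStarVertex v → IsStarVertex (φ v)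
  starVertex (x , x-vertex , refl) = Φ x , Φ-vertex x x-vertex , outW-Φ x

  starArc : ∀ {v w} → StarArc v w → StarArc (φ v) (φ w)
  starArc (v-vertex , w-vertex , y , y-vertex , refl , refl) =
    starVertex v-vertex , starVertex w-vertex , Φ y , Φ-vertex y y-vertex , inW-Φ y , outW-Φ y

  InN*-closed : ∀ {v} → InN* v → InN* (φ v)
  InN*-closed (base z) =
    subst InN* (sym φ-zeroWord) (base (subst IsStarVertex φ-zeroWord (starVertex z)))
  InN*-closed (fwd n arc) = fwd (InN*-closed n) (starArc arc)
  InN*-closed (bwd n arc) = bwd (InN*-closed n) (starArc arc)

Chain : ∀ {n} → Letter → Vec Letter n → Letter → Set
Chain p []       q = ArcUD p q
Chain p (x ∷ xs) q = ArcUD p x × Chain x xs q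

-- For p = q = x this is IsDmVertex (x ∷ xs), since rot (x ∷ xs) = xs ∷ʳ x.
ArcsAlong : ∀ {n} → Letter → Vec Letter n → Letter → Set
ArcsAlong p xs q = ∀ i → ArcUD (lookup (p ∷ xs) i) (lookup (xs ∷ʳ q) i)

chain⇒arcsAlong : ∀ {n} p (xs : Vec Letter n) q → Chain p xs q → ArcsAlong p xs q
chain⇒arcsAlong p []       q pq          Fin.zero    = pq
chain⇒arcsAlong p (x ∷ xs) q (px , _)    Fin.zero    = px
chain⇒arcsAlong p (x ∷ xs) q (_ , chain) (Fin.suc i) = chain⇒arcsAlong x xs q chain i

arcsAlong⇒chain : ∀ {n} p (xs : Vec Letter n) q → ArcsAlong p xs q → Chain p xs q
arcsAlong⇒chain p []       q arcs = arcs Fin.zero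
arcsAlong⇒chain p (x ∷ xs) q arcs =
  arcs Fin.zero , arcsAlong⇒chain x xs q (λ i → arcs (Fin.suc i))

chain-∷ʳ : ∀ {n} p (xs : Vec Letter n) x q → Chain p xs x → ArcUD x q → Chain p (xs ∷ʳ x) q
chain-∷ʳ p []       x q px        xq = px , xq
chain-∷ʳ p (y ∷ xs) x q (py , yx) xq = py , chain-∷ʳ y xs x q yx xq

rot-vertex : ∀ {m} (y : Vec Letter m) → IsDmVertex y → IsDmVertex (rot y)
rot-vertex (x ∷ [])     x-vertex = x-vertex
rot-vertex (x ∷ z ∷ zs) y-vertex with arcsAlong⇒chain x (z ∷ zs) x y-vertex
... | xz , zx = chain⇒arcsAlong z (zs ∷ʳ x) z (chain-∷ʳ z zs x z zx xz)

rot-map : ∀ {A B : Set} {m} (g : A → B) (v : Vec A m) → rot (map g v) ≡ map g (rot v)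
rot-map g []       = refl
rot-map g (x ∷ xs) = sym (map-∷ʳ g x xs)

replicate-∷ʳ : ∀ {A : Set} n (x : A) → replicate n x ∷ʳ x ≡ x ∷ replicate n x
replicate-∷ʳ zero    x = refl
replicate-∷ʳ (suc n) x = cong (x ∷_) (replicate-∷ʳ n x)

rot-replicate : ∀ {A : Set} n (x : A) → rot (replicate n x) ≡ replicate n x
rot-replicate zero    x = refl
rot-replicate (suc n) x = replicate-∷ʳ n x

rot-InN* : ∀ {m} {v : Vec Bool m} → InN* v → InN* (rot v)
rot-InN* {m} = Symmetry.InN*-closed rot rot rot-vertex
  (λ y → sym (rot-map outL y)) (λ y → sym (rot-map inL y)) (rot-replicate m _)

rotIter-InN* : ∀ {m} k {v : Vec Bool m} → InN* v → InN* (rotIter k v)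
rotIter-InN* zero    n = n
rotIter-InN* (suc k) n = rot-InN* (rotIter-InN* k n)

swapUD : Letter → Letter
swapUD a = c
swapUD b = b
swapUD c = a
swapUD d = f
swapUD e = e
swapUD f = d

hasUp-swapUD : ∀ l → hasUp (swapUD l) ≡ hasDown l
hasUp-swapUD a = refl
hasUp-swapUD b = refl
hasUp-swapUD c = refl
hasUp-swapUD d = refl
hasUp-swapUD e = refl
hasUp-swapUD f = refl

hasDown-swapUD : ∀ l → hasDown (swapUD l) ≡ hasUp l
hasDown-swapUD a = refl
hasDown-swapUD b = refl
hasDown-swapUD c = refl
hasDown-swapUD d = refl
hasDown-swapUD e = refl
hasDown-swapUD f = refl

outL-swapUD : ∀ l → outL (swapUD l) ≡ outL l
outL-swapUD a = refl
outL-swapUD b = refl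
outL-swapUD c = refl
outL-swapUD d = refl
outL-swapUD e = refl
outL-swapUD f = refl

inL-swapUD : ∀ l → inL (swapUD l) ≡ inL l
inL-swapUD a = refl
inL-swapUD b = refl
inL-swapUD c = refl
inL-swapUD d = refl
inL-swapUD e = refl
inL-swapUD f = refl

arcUD-swapUD : ∀ p q → ArcUD p q → ArcUD (swapUD q) (swapUD p)
arcUD-swapUD p q pq = begin
  hasDown (swapUD q) ≡⟨ hasDown-swapUD q ⟩
  hasUp q            ≡⟨ sym pq ⟩
  hasDown p          ≡⟨ sym (hasUp-swapUD p) ⟩
  hasUp (swapUD p)   ∎
  where open ≡-Reasoning

mirror : ∀ {n} → Vec Letter n → Vec Letter n
mirror y = map swapUD (reverse y)

mirror-∷ : ∀ {n} x (xs : Vec Letter n) → mirror (x ∷ xs) ≡ mirror xs ∷ʳ swapUD x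
mirror-∷ x xs = begin
  map swapUD (reverse (x ∷ xs))  ≡⟨ cong (map swapUD) (reverse-∷ x xs) ⟩
  map swapUD (reverse xs ∷ʳ x)   ≡⟨ map-∷ʳ swapUD x (reverse xs) ⟩
  mirror xs ∷ʳ swapUD x          ∎
  where open ≡-Reasoning

chain-mirror : ∀ {n} p (xs : Vec Letter n) q →
  Chain p xs q → Chain (swapUD q) (mirror xs) (swapUD p)
chain-mirror p []       q pq = arcUD-swapUD p q pq
chain-mirror p (x ∷ xs) q (px , xq) =
  subst (λ ys → Chain (swapUD q) ys (swapUD p)) (sym (mirror-∷ x xs))
    (chain-∷ʳ (swapUD q) (mirror xs) (swapUD x) (swapUD p)
      (chain-mirror x xs q xq) (arcUD-swapUD p x px))

-- The mirrored cycle starts at swapUD x, so mirror (x ∷ xs) is its rotation.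
mirror-vertex : ∀ {m} (y : Vec Letter m) → IsDmVertex y → IsDmVertex (mirror y)
mirror-vertex (x ∷ xs) y-vertex =
  subst IsDmVertex (sym (mirror-∷ x xs))
    (rot-vertex (swapUD x ∷ mirror xs)
      (chain⇒arcsAlong (swapUD x) (mirror xs) (swapUD x)
        (chain-mirror x xs x (arcsAlong⇒chain x xs x y-vertex))))

map-mirror : ∀ {m} (g : Letter → Bool) → (∀ l → g (swapUD l) ≡ g l) →
  (y : Vec Letter m) → map g (mirror y) ≡ reverse (map g y)
map-mirror g g-swapUD y = begin
  map g (map swapUD (reverse y))  ≡⟨ map-∘ g swapUD (reverse y) ⟨
  map (g ∘ swapUD) (reverse y)    ≡⟨ map-cong g-swapUD (reverse y) ⟩
  map g (reverse y)               ≡⟨ map-reverse g y ⟩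
  reverse (map g y)               ∎
  where open ≡-Reasoning

reverse-replicate : ∀ {A : Set} n (x : A) → reverse (replicate n x) ≡ replicate n x
reverse-replicate zero    x = refl
reverse-replicate (suc n) x = begin
  reverse (x ∷ replicate n x)  ≡⟨ reverse-∷ x (replicate n x) ⟩
  reverse (replicate n x) ∷ʳ x ≡⟨ cong (_∷ʳ x) (reverse-replicate n x) ⟩
  replicate n x ∷ʳ x           ≡⟨ replicate-∷ʳ n x ⟩
  x ∷ replicate n x            ∎
  where open ≡-Reasoning

reverse-InN* : ∀ {m} {v : Vec Bool m} → InN* v → InN* (reverse v)
reverse-InN* {m} = Symmetry.InN*-closed reverse mirror mirror-vertex
  (map-mirror outL outL-swapUD) (map-mirror inL inL-swapUD) (reverse-replicate m _)

theorem6 : (m : ℕ) → m ≥ 1 → (v : Vec Bool m) → InN* v →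
    InN* (reverse v) × ((k : ℕ) → k < m → InN* (rotIter k v))
theorem6 m _ v n = reverse-InN* n , λ k _ → rotIter-InN* k n
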